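{- Let $H$ be a $k$-uniform hypergraph with $n$ vertices and multiple distinct edges. Let $m\in\{1,2,\ldots,k-1\}$, $p_1=\frac{m}{k}$, and $p_2\in\left(\frac{m}{k},\frac{m+1}{k}\right)$. Then $b_{L,p_1}(H)<b_{L,p_2}(H)$ and $b_{p_1}(H)<b_{p_2}(H)$.
   Context: A hypergraph $H=(V(H),E(H))$ has a finite nonempty vertex set and a finite collection $E(H)$ of subsets of $V(H)$ called edges; it is $k$-uniform if every edge has exactly $k$ vertices. For a proportion $p\in(0,1)$, the proportion-based propagation rule is: if at the end of a round at least $\lceil p|e|\rceil$ vertices of an edge $e$ are on fire, then in the next round all vertices of $e$ catch fire; burned vertices stay burned. Burning game: let $F_0=\emptyset$ and $F_r$ be the set of burned vertices at the end of round $r$. In each round $r\geq 1$, simultaneously, vertices catch fire by propagation from $F_{r-1}$ (no propagation in round 1), and a player chooses a vertex $u_r\notin F_{r-1}$ (a source) and sets it on fire. A burning sequence is a sequence $(u_1,\ldots,u_k)$ of such sources after which every vertex is on fire at the end of round $k$; $b_p(H)$ is the minimum length of a burning sequence. Lazy game: $S\subseteq V(H)$ is a lazy burning set if, setting all of $S$ on fire at once and then repeatedly applying the propagation rule, every vertex eventually catches fire; $b_{L,p}(H)$ is the minimum size of a lazy burning set. -}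

module Defs where

open import Data.Nat using (ℕ; zero; suc; _≤_)
open import Data.Integer as ℤ using (ℤ; +_)
import Data.Integer.Properties as ℤP
open import Data.Rational as ℚ using (ℚ; ceiling; _/_)
open import Data.Fin using (Fin)
open import Data.Fin.Subset using (Subset; ⊥; ⊤; ⁅_⁆; _∪_; _∩_; ∣_∣; _∉_)
open import Data.List using (List; []; _∷_; length)
open import Data.List.Membership.Propositional using (_∈_)
open import Data.List.Relation.Unary.All using (All)
open import Data.Product using (Σ; _×_; ∃)
open import Relation.Binary.PropositionalEquality using (_≡_; _≢_)
open import Relation.Nullary using (yes; no)

record Hypergraph : Set where
  field
    n     : ℕ
    edges : List (Subset n)
open Hypergraph public

NonemptyVertices : Hypergraph → Set
NonemptyVertices H = 1 ≤ n H

Uniform : ℕ → Hypergraph → Set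
Uniform k H = All (λ e → ∣ e ∣ ≡ k) (edges H)

MultipleDistinctEdges : Hypergraph → Set
MultipleDistinctEdges H =
  Σ (Subset (n H)) λ e → Σ (Subset (n H)) λ f → e ∈ edges H × f ∈ edges H × e ≢ f

threshold : ℚ → {m : ℕ} → Subset m → ℤ
threshold p e = ⌈ p ℚ.* ((+ ∣ e ∣) / 1) ⌉

spreadEdges : ℚ → {m : ℕ} → List (Subset m) → Subset m → Subset m
spreadEdges p [] F = ⊥
spreadEdges p (e ∷ es) F with threshold p e ℤ.≤? (+ ∣ e ∩ F ∣)
... | yes _ = e ∪ spreadEdges p es F
... | no  _ = spreadEdges p es F

step : ℚ → (H : Hypergraph) → Subset (n H) → Subset (n H)
step p H F = F ∪ spreadEdges p (edges H) F

iterate : {A : Set} → (A → A) → ℕ → A → A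
iterate f zero    x = x
iterate f (suc t) x = f (iterate f t x)

-- Burning game.  burnsFrom F us : starting with F = F_{r-1} burned, the
-- remaining sources us are legal and everything is burned at the end.
burnsFrom : ℚ → (H : Hypergraph) → Subset (n H) → List (Fin (n H)) → Set
burnsFrom p H F []       = F ≡ ⊤
burnsFrom p H F (u ∷ us) = u ∉ F × burnsFrom p H (step p H F ∪ ⁅ u ⁆) us

-- Round 1: F_0 = ∅, no propagation, the first source is set on fire.
IsBurningSequence : ℚ → (H : Hypergraph) → List (Fin (n H)) → Set
IsBurningSequence p H []       = ⊥ {n H} ≡ ⊤
IsBurningSequence p H (u ∷ us) = burnsFrom p H ⁅ u ⁆ us

IsBurningNumber : ℚ → Hypergraph → ℕ → Set
IsBurningNumber p H b =
  (Σ (List (Fin (n H))) λ s → IsBurningSequence p H s × length s ≡ b)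
  × (∀ s → IsBurningSequence p H s → b ≤ length s)

IsLazyBurningSet : ℚ → (H : Hypergraph) → Subset (n H) → Set
IsLazyBurningSet p H S = ∃ λ t → iterate (step p H) t S ≡ ⊤

IsLazyBurningNumber : ℚ → Hypergraph → ℕ → Set
IsLazyBurningNumber p H b =
  (Σ (Subset (n H)) λ S → IsLazyBurningSet p H S × ∣ S ∣ ≡ b)
  × (∀ S → IsLazyBurningSet p H S → b ≤ ∣ S ∣)

module Submission where

-- For k-uniform edges the proportion m/k sets an edge on fire once m of its vertices burn, while
-- any p₂ > m/k needs m + 1.  Hence p₂-propagation from F is contained in m/k-propagation from any G
-- that misses at most one vertex of F.
-- Lazy game: an optimal p₂-set S has an edge with more than m vertices in S (otherwise nothing
-- spreads and S is everything); removing one of them leaves an m/k-lazy burning set.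
-- Burning game: replay an optimal p₂-sequence under m/k.  Until the p₂-fire first spreads it
-- consists of the sources alone; the edge that spreads first contains the newest source and held
-- m burned vertices a round earlier, so from then on m/k is a round ahead.  If it never spreads,
-- the sequence has length n, whereas under m/k filling one edge e while keeping a vertex outside e
-- unburned makes some vertex catch fire unchosen, which saves a round.

open import Defs
open import Data.Nat using (ℕ; suc; _≤_; _<_; NonZero)
open import Data.Integer using (+_)
open import Data.Rational using (ℚ; _/_) renaming (_<_ to _<ℚ_)
open import Data.Product using (_×_)

open import Data.Nat using (zero; z≤n; s≤s; _+_; _∸_; _<?_)
open import Data.Nat.Properties
open import Data.Integer as ℤ using (-[1+_]; +[1+_]; +≤+)
import Data.Integer.Properties as ℤP
import Data.Integer.DivMod as ℤD
open import Data.Rational as ℚ using (mkℚ; ↥_; ↧_)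
import Data.Rational.Properties as ℚP
open import Data.Rational.Unnormalised as ℚᵘ using (mkℚᵘ; *≡*; *≤*; *<*)
import Data.Rational.Unnormalised.Properties as ℚᵘP
open import Data.Nat.Coprimality using (Coprime)
open import Data.Fin using (Fin; zero; suc) renaming (_≟_ to _≟ᶠ_)
import Data.Fin.Properties as FinP
open import Data.Fin.Subset
  using (Subset; ⊤; ⊥; ⁅_⁆; _∪_; _∩_; _-_; ∣_∣; _∈_; _∉_; _⊆_; Nonempty; inside; outside)
open import Data.Fin.Subset.Properties
open import Data.List using (List; []; _∷_; length)
open import Data.List.Membership.Propositional using (find; lose) renaming (_∈_ to _∈ₗ_)
open import Data.List.Relation.Unary.Any using (here; there; any?)
import Data.List.Relation.Unary.All as All
open import Data.Product using (Σ; ∃; _,_; proj₁; proj₂)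
open import Data.Sum as Sum using (_⊎_; inj₁; inj₂)
open import Data.Empty using (⊥-elim)
open import Data.Vec using (_∷_)
open import Function using (_∘_; case_of_)
open import Relation.Binary.PropositionalEquality
open import Relation.Nullary using (yes; no; ¬_; contradiction)
open import Relation.Nullary.Decidable using (_×-dec_; ¬?; decidable-stable)

⌈mkℚ⌉ : ∀ a d .(c : Coprime ℤ.∣ a ∣ (suc d)) → ℚ.ceiling (mkℚ a d c) ≡ ℤ.- ((ℤ.- a) ℤ./ + suc d)
⌈mkℚ⌉ (+ zero)  d c = refl
⌈mkℚ⌉ +[1+ n ]  d c = refl
⌈mkℚ⌉ -[1+ n ]  d c = refl

↥x≤⌈x⌉*↧x : ∀ x → ↥ x ℤ.≤ ℚ.ceiling x ℤ.* ↧ x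
↥x≤⌈x⌉*↧x (mkℚ a d c) rewrite ⌈mkℚ⌉ a d c =
  subst₂ ℤ._≤_ (ℤP.neg-involutive a) (ℤP.neg-distribˡ-* q (+ suc d))
    (ℤP.neg-mono-≤ (ℤD.[n/d]*d≤n (ℤ.- a) (+ suc d)))
  where q = (ℤ.- a) ℤ./ + suc d

↥x≤z*↧x⇒⌈x⌉≤z : ∀ x z → ↥ x ℤ.≤ z ℤ.* ↧ x → ℚ.ceiling x ℤ.≤ z
↥x≤z*↧x⇒⌈x⌉≤z (mkℚ a d c) z a≤zd rewrite ⌈mkℚ⌉ a d c =
  subst (ℤ.- q ℤ.≤_) (ℤP.neg-involutive z) (ℤP.neg-mono-≤ -z≤q)
  where
  q = (ℤ.- a) ℤ./ + suc d
  -zd≤-a : (ℤ.- z) ℤ.* + suc d ℤ.≤ ℤ.- a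
  -zd≤-a = subst (ℤ._≤ ℤ.- a) (ℤP.neg-distribˡ-* z (+ suc d)) (ℤP.neg-mono-≤ a≤zd)
  -a<[q+1]d : ℤ.- a ℤ.< ℤ.suc q ℤ.* + suc d
  -a<[q+1]d = subst (λ t → ℤ.- a ℤ.< ℤ.suc t ℤ.* + suc d)
    (sym (ℤD.div-pos-is-/ℕ (ℤ.- a) (suc d))) (ℤD.n<s[n/ℕd]*d (ℤ.- a) (suc d))
  -z<q+1 : ℤ.- z ℤ.< ℤ.suc q
  -z<q+1 = ℤP.*-cancelʳ-<-nonNeg (+ suc d) (ℤP.≤-<-trans -zd≤-a -a<[q+1]d)
  -z≤q : ℤ.- z ℤ.≤ q
  -z≤q = subst (ℤ.- z ℤ.≤_) (ℤP.pred-suc q) (ℤP.i<j⇒i≤pred[j] -z<q+1)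

x≤z⇒⌈x⌉≤z : ∀ x z → x ℚ.≤ z / 1 → ℚ.ceiling x ℤ.≤ z
x≤z⇒⌈x⌉≤z x@(mkℚ a d c) z x≤z with ℚᵘP.≤-respʳ-≃ (ℚP.toℚᵘ-fromℚᵘ (mkℚᵘ z 0)) (ℚP.toℚᵘ-mono-≤ x≤z)
... | *≤* a≤zd = ↥x≤z*↧x⇒⌈x⌉≤z x z (subst (ℤ._≤ z ℤ.* ↧ x) (ℤP.*-identityʳ a) a≤zd)

z<x⇒z<⌈x⌉ : ∀ x z → z / 1 ℚ.< x → z ℤ.< ℚ.ceiling x
z<x⇒z<⌈x⌉ x@(mkℚ a d c) z z<x with ℚᵘP.<-respˡ-≃ (ℚP.toℚᵘ-fromℚᵘ (mkℚᵘ z 0)) (ℚP.toℚᵘ-mono-< z<x)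
... | *<* zd<a = ℤP.*-cancelʳ-<-nonNeg (↧ x)
  (ℤP.<-≤-trans (subst (z ℤ.* ↧ x ℤ.<_) (ℤP.*-identityʳ a) zd<a) (↥x≤⌈x⌉*↧x x))

i/k*k≡i/1 : ∀ i k .{{_ : NonZero k}} → (i / k) ℚ.* (+ k / 1) ≡ i / 1
i/k*k≡i/1 i (suc k) = ℚP.toℚᵘ-injective (begin
  ℚ.toℚᵘ ((i / suc k) ℚ.* (+ suc k / 1))           ≈⟨ ℚP.toℚᵘ-homo-* (i / suc k) (+ suc k / 1) ⟩
  ℚ.toℚᵘ (i / suc k) ℚᵘ.* ℚ.toℚᵘ (+ suc k / 1)     ≈⟨ ℚᵘP.*-cong (ℚP.toℚᵘ-fromℚᵘ (mkℚᵘ i k)) (ℚP.toℚᵘ-fromℚᵘ (mkℚᵘ (+ suc k) 0)) ⟩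
  mkℚᵘ i k ℚᵘ.* mkℚᵘ (+ suc k) 0                    ≈⟨ *≡* (trans (ℤP.*-identityʳ (i ℤ.* + suc k)) (cong (λ t → i ℤ.* + t) (sym (*-identityʳ (suc k))))) ⟩
  mkℚᵘ i 0                                          ≈⟨ ℚᵘP.≃-sym (ℚP.toℚᵘ-fromℚᵘ (mkℚᵘ i 0)) ⟩
  ℚ.toℚᵘ (i / 1)                                    ∎)
  where open ℚᵘP.≃-Reasoning

threshold[m/k]≤m : ∀ {N} k m .{{_ : NonZero k}} (e : Subset N) → ∣ e ∣ ≡ k → threshold (+ m / k) e ℤ.≤ + m
threshold[m/k]≤m k m e refl = x≤z⇒⌈x⌉≤z _ (+ m) (ℚP.≤-reflexive (i/k*k≡i/1 (+ m) k))

m/k<p⇒m<threshold : ∀ {N} k m .{{_ : NonZero k}} p (e : Subset N) → ∣ e ∣ ≡ k → + m / k ℚ.< p → + m ℤ.< threshold p e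
m/k<p⇒m<threshold k m p e refl m/k<p = z<x⇒z<⌈x⌉ _ (+ m)
  (subst (ℚ._< p ℚ.* (+ k / 1)) (i/k*k≡i/1 (+ m) k)
    (ℚP.*-monoˡ-<-pos (+ k / 1) {{ℚP.normalize-pos k 1}} m/k<p))

m≤1+n+o∧o<p⇒m≤n+p : ∀ {m n o p} → m ≤ suc n + o → o < p → m ≤ n + p
m≤1+n+o∧o<p⇒m≤n+p {n = n} {o} m≤ o<p = ≤-trans m≤ (≤-trans (≤-reflexive (sym (+-suc n o))) (+-monoʳ-≤ n o<p))

module _ {n : ℕ} where

  ⊆-or-outside : (p q : Subset n) → p ⊆ q ⊎ ∃ λ x → x ∈ p × x ∉ q
  ⊆-or-outside p q with FinP.any? (λ x → (x ∈? p) ×-dec ¬? (x ∈? q))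
  ... | yes escape = inj₂ escape
  ... | no ∄escape = inj₁ λ {x} x∈p → decidable-stable (x ∈? q) λ x∉q → ∄escape (x , x∈p , x∉q)

  ⊈⇒outside : {p q : Subset n} → ¬ p ⊆ q → ∃ λ x → x ∈ p × x ∉ q
  ⊈⇒outside {p} {q} p⊈q with ⊆-or-outside p q
  ... | inj₁ p⊆q   = ⊥-elim (p⊈q p⊆q)
  ... | inj₂ escape = escape

  ⊤⊆⇒≡⊤ : {p : Subset n} → ⊤ ⊆ p → p ≡ ⊤
  ⊤⊆⇒≡⊤ ⊤⊆p = ⊆-antisym ⊆⊤ ⊤⊆p

  ≡⊤-or-outside : (p : Subset n) → p ≡ ⊤ ⊎ ∃ λ x → x ∉ p
  ≡⊤-or-outside p = Sum.map ⊤⊆⇒≡⊤ (λ (x , _ , x∉p) → x , x∉p) (⊆-or-outside ⊤ p)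

  ≡⊤⇒n≤∣p∣ : {p : Subset n} → p ≡ ⊤ → n ≤ ∣ p ∣
  ≡⊤⇒n≤∣p∣ refl = ≤-reflexive (sym (∣⊤∣≡n n))

  x∉p⇒∣p∣<n : ∀ {x} {p : Subset n} → x ∉ p → ∣ p ∣ < n
  x∉p⇒∣p∣<n {p = p} x∉p = subst (∣ p ∣ <_) (∣⊤∣≡n n) (p⊂q⇒∣p∣<∣q∣ (⊆⊤ , _ , ∈⊤ , x∉p))

  x∉p⇒∣p∣<∣p∪⁅x⁆∣ : ∀ {x} {p : Subset n} → x ∉ p → ∣ p ∣ < ∣ p ∪ ⁅ x ⁆ ∣
  x∉p⇒∣p∣<∣p∪⁅x⁆∣ {x} x∉p = p⊂q⇒∣p∣<∣q∣ (p⊆p∪q _ , x , x∈p∪q⁺ (inj₂ (x∈⁅x⁆ x)) , x∉p)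

  two-outside : ∀ {x y} {p : Subset n} → x ∉ p → y ∉ p → x ≢ y → suc ∣ p ∣ < n
  two-outside {x} {y} {p} x∉p y∉p x≢y = ≤-trans (s≤s (x∉p⇒∣p∣<∣p∪⁅x⁆∣ x∉p)) (x∉p⇒∣p∣<n y∉p∪⁅x⁆)
    where
    y∉p∪⁅x⁆ : y ∉ p ∪ ⁅ x ⁆
    y∉p∪⁅x⁆ y∈ = Sum.[ y∉p , x≢y ∘ sym ∘ x∈⁅y⁆⇒x≡y x ] (x∈p∪q⁻ p _ y∈)

  0<∣p∣⇒nonempty : {p : Subset n} → 0 < ∣ p ∣ → Nonempty p
  0<∣p∣⇒nonempty {p} 0<∣p∣ with nonempty? p
  ... | yes ne = ne
  ... | no empty = contradiction (trans (cong ∣_∣ (Empty-unique empty)) (∣⊥∣≡0 n)) (>⇒≢ 0<∣p∣)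

  ∪-⊆ : {p q r : Subset n} → p ⊆ r → q ⊆ r → p ∪ q ⊆ r
  ∪-⊆ {p} p⊆r q⊆r x∈ = Sum.[ p⊆r , q⊆r ] (x∈p∪q⁻ p _ x∈)

  ∪-monoˡ : {p q r : Subset n} → p ⊆ q → p ∪ r ⊆ q ∪ r
  ∪-monoˡ {q = q} p⊆q = ∪-⊆ (p⊆p∪q _ ∘ p⊆q) (q⊆p∪q q _)

  ∪⁅x⁆⊆ : {p q : Subset n} {x : Fin n} → p ⊆ q → x ∈ q → p ∪ ⁅ x ⁆ ⊆ q
  ∪⁅x⁆⊆ {q = q} p⊆q x∈q = ∪-⊆ p⊆q (λ y∈⁅x⁆ → subst (_∈ q) (sym (x∈⁅y⁆⇒x≡y _ y∈⁅x⁆)) x∈q)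

  ∩-monoʳ : (e : Subset n) {p q : Subset n} → p ⊆ q → e ∩ p ⊆ e ∩ q
  ∩-monoʳ e {p} p⊆q x∈ = let x∈e , x∈p = x∈p∩q⁻ e p x∈ in x∈p∩q⁺ (x∈e , p⊆q x∈p)

  p⊆p-x∪⁅x⁆ : (p : Subset n) (x : Fin n) → p ⊆ (p - x) ∪ ⁅ x ⁆
  p⊆p-x∪⁅x⁆ p x {y} y∈p with y ≟ᶠ x
  ... | yes refl = x∈p∪q⁺ (inj₂ (x∈⁅x⁆ x))
  ... | no y≢x = x∈p∪q⁺ (inj₁ (x∈p∧x≢y⇒x∈p-y y∈p y≢x))

∣p∪⁅x⁆∣≤1+∣p∣ : ∀ {n} (p : Subset n) x → ∣ p ∪ ⁅ x ⁆ ∣ ≤ suc ∣ p ∣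
∣p∪⁅x⁆∣≤1+∣p∣ (outside ∷ p) zero    = s≤s (≤-reflexive (cong ∣_∣ (∪-identityʳ p)))
∣p∪⁅x⁆∣≤1+∣p∣ (inside  ∷ p) zero    = s≤s (m≤n⇒m≤1+n (≤-reflexive (cong ∣_∣ (∪-identityʳ p))))
∣p∪⁅x⁆∣≤1+∣p∣ (outside ∷ p) (suc x) = ∣p∪⁅x⁆∣≤1+∣p∣ p x
∣p∪⁅x⁆∣≤1+∣p∣ (inside  ∷ p) (suc x) = s≤s (∣p∪⁅x⁆∣≤1+∣p∣ p x)

∣e∩p∣≤1+∣e∩q∣ : ∀ {n} (e : Subset n) {p q : Subset n} {x} → p ⊆ q ∪ ⁅ x ⁆ → ∣ e ∩ p ∣ ≤ suc ∣ e ∩ q ∣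
∣e∩p∣≤1+∣e∩q∣ e {p} {q} {x} p⊆q∪⁅x⁆ = ≤-trans (p⊆q⇒∣p∣≤∣q∣ e∩p⊆) (∣p∪⁅x⁆∣≤1+∣p∣ (e ∩ q) x)
  where
  e∩p⊆ : e ∩ p ⊆ (e ∩ q) ∪ ⁅ x ⁆
  e∩p⊆ y∈ with x∈p∩q⁻ e p y∈
  ... | y∈e , y∈p = Sum.[ x∈p∪q⁺ ∘ inj₁ ∘ x∈p∩q⁺ ∘ (y∈e ,_) , x∈p∪q⁺ ∘ inj₂ ] (x∈p∪q⁻ q _ (p⊆q∪⁅x⁆ y∈p))

Ignites : ℚ → ∀ {N} → Subset N → Subset N → Set
Ignites p F e = threshold p e ℤ.≤ + ∣ e ∩ F ∣

ignites-mono : ∀ p {N} {F G e : Subset N} → ∣ e ∩ F ∣ ≤ ∣ e ∩ G ∣ → Ignites p F e → Ignites p G e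
ignites-mono p ∣e∩F∣≤∣e∩G∣ ignites = ℤP.≤-trans ignites (+≤+ ∣e∩F∣≤∣e∩G∣)

module _ (p : ℚ) {N : ℕ} (F : Subset N) where

  ∈spreadEdges⁻ : ∀ es {x} → x ∈ spreadEdges p es F → ∃ λ e → e ∈ₗ es × Ignites p F e × x ∈ e
  ∈spreadEdges⁻ []       x∈ = ⊥-elim (∉⊥ x∈)
  ∈spreadEdges⁻ (e ∷ es) x∈ with threshold p e ℤ.≤? (+ ∣ e ∩ F ∣)
  ... | no _ = let e' , e'∈ , ign , x∈e' = ∈spreadEdges⁻ es x∈ in e' , there e'∈ , ign , x∈e'
  ... | yes ign with x∈p∪q⁻ e _ x∈
  ...   | inj₁ x∈e = e , here refl , ign , x∈e
  ...   | inj₂ x∈ᵣ = let e' , e'∈ , ign' , x∈e' = ∈spreadEdges⁻ es x∈ᵣ in e' , there e'∈ , ign' , x∈e'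

  spreadEdges⁺ : ∀ {es e} → e ∈ₗ es → Ignites p F e → e ⊆ spreadEdges p es F
  spreadEdges⁺ {e ∷ es} (here refl) ign x∈e with threshold p e ℤ.≤? (+ ∣ e ∩ F ∣)
  ... | yes _    = x∈p∪q⁺ (inj₁ x∈e)
  ... | no ¬ign = contradiction ign ¬ign
  spreadEdges⁺ {e' ∷ es} (there e∈) ign x∈e with threshold p e' ℤ.≤? (+ ∣ e' ∩ F ∣)
  ... | yes _ = x∈p∪q⁺ (inj₂ (spreadEdges⁺ e∈ ign x∈e))
  ... | no _  = spreadEdges⁺ e∈ ign x∈e

BurnsWithin : ℚ → (H : Hypergraph) → Subset (n H) → ℕ → Set
BurnsWithin p H G t = Σ (List (Fin (n H))) λ us → burnsFrom p H G us × length us ≤ t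

module _ (p : ℚ) (H : Hypergraph) where

  private
    N = n H

  ⊆-step : {G : Subset N} → G ⊆ step p H G
  ⊆-step = p⊆p∪q _

  spreadEdges⊆step : {G : Subset N} → spreadEdges p (edges H) G ⊆ step p H G
  spreadEdges⊆step {G} = q⊆p∪q G _

  ∈step∧∉⇒∈spreadEdges : ∀ {G x} → x ∈ step p H G → x ∉ G → x ∈ spreadEdges p (edges H) G
  ∈step∧∉⇒∈spreadEdges {G} x∈ x∉G with x∈p∪q⁻ G _ x∈
  ... | inj₁ x∈G      = contradiction x∈G x∉G
  ... | inj₂ x∈spread = x∈spread

  ∣step∪⁅w⁆∣≤1+∣G∣ : ∀ {G w} → step p H G ⊆ G → ∣ step p H G ∪ ⁅ w ⁆ ∣ ≤ suc ∣ G ∣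
  ∣step∪⁅w⁆∣≤1+∣G∣ {G} {w} closed = ≤-trans (p⊆q⇒∣p∣≤∣q∣ (∪-monoˡ closed)) (∣p∪⁅x⁆∣≤1+∣p∣ G w)

  ∣G∣<∣step∪⁅w⁆∣ : ∀ {G w} → w ∉ G → ∣ G ∣ < ∣ step p H G ∪ ⁅ w ⁆ ∣
  ∣G∣<∣step∪⁅w⁆∣ {G} {w} w∉G =
    ≤-trans (x∉p⇒∣p∣<∣p∪⁅x⁆∣ w∉G) (p⊆q⇒∣p∣≤∣q∣ (∪-monoˡ {p = G} {r = ⁅ w ⁆} ⊆-step))

  burns-after : ∀ {G w t} → w ∉ G → BurnsWithin p H (step p H G ∪ ⁅ w ⁆) t → BurnsWithin p H G (suc t)
  burns-after w∉G (us , burns , len≤t) = _ ∷ us , (w∉G , burns) , s≤s len≤t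

  burns-matching : ∀ {G X u t} → X ⊆ step p H G → (∀ {G'} → X ∪ ⁅ u ⁆ ⊆ G' → BurnsWithin p H G' t) →
                   BurnsWithin p H G (suc t)
  burns-matching {G} {X} {u} X⊆ burns-beyond with u ∈? G
  ... | no u∉G = burns-after u∉G (burns-beyond (∪-monoˡ X⊆))
  ... | yes u∈G with ≡⊤-or-outside G
  ...   | inj₁ G≡⊤        = [] , G≡⊤ , z≤n
  ...   | inj₂ (w , w∉G) = burns-after w∉G (burns-beyond (⊆-trans (∪⁅x⁆⊆ X⊆ (⊆-step u∈G)) (p⊆p∪q _)))

  burns-by-counting : ∀ t G → N ≤ t + ∣ G ∣ → BurnsWithin p H G t
  burns-by-counting t G N≤ with ≡⊤-or-outside G
  ... | inj₁ G≡⊤ = [] , G≡⊤ , z≤n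
  burns-by-counting zero    G N≤ | inj₂ (w , w∉G) = contradiction N≤ (<⇒≱ (x∉p⇒∣p∣<n w∉G))
  burns-by-counting (suc t) G N≤ | inj₂ (w , w∉G) =
    burns-after w∉G (burns-by-counting t _ (m≤1+n+o∧o<p⇒m≤n+p N≤ (∣G∣<∣step∪⁅w⁆∣ w∉G)))

  -- A vertex that catches fire without being chosen saves one round over counting.
  burns-gaining : ∀ t {G x y z} → z ∈ step p H G → z ∉ G → x ∉ G → y ∉ G → x ≢ y →
                  N ≤ t + suc ∣ G ∣ → BurnsWithin p H G t
  burns-gaining zero    z∈ z∉G x∉G y∉G x≢y N≤ = contradiction N≤ (<⇒≱ (two-outside x∉G y∉G x≢y))
  burns-gaining (suc t) {G} {z = z} z∈ z∉G x∉G y∉G x≢y N≤ with ≡⊤-or-outside (step p H G)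
  ... | inj₁ step≡⊤ = burns-after z∉G (burns-by-counting t _
          (≤-trans (≡⊤⇒n≤∣p∣ step≡⊤) (≤-trans (∣p∣≤∣p∪q∣ (step p H G) ⁅ z ⁆) (m≤n+m _ t))))
  ... | inj₂ (w , w∉step) = burns-after (w∉step ∘ ⊆-step) (burns-by-counting t _
          (m≤1+n+o∧o<p⇒m≤n+p N≤ (≤-trans (s≤s ∣G∣<∣step∣) (x∉p⇒∣p∣<∣p∪⁅x⁆∣ w∉step))))
    where
    ∣G∣<∣step∣ : ∣ G ∣ < ∣ step p H G ∣
    ∣G∣<∣step∣ = p⊂q⇒∣p∣<∣q∣ (⊆-step , z , z∈ , z∉G)

iterate-fixed : ∀ {A : Set} (f : A → A) {x} → f x ≡ x → ∀ t → iterate f t x ≡ x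
iterate-fixed f fx≡x zero    = refl
iterate-fixed f fx≡x (suc t) = trans (cong f (iterate-fixed f fx≡x t)) fx≡x

iterate-suc : ∀ {A : Set} (f : A → A) x t → iterate f (suc t) x ≡ iterate f t (f x)
iterate-suc f x zero    = refl
iterate-suc f x (suc t) = cong f (iterate-suc f x t)

closed-lazy⇒≡⊤ : ∀ p H {S} → step p H S ⊆ S → IsLazyBurningSet p H S → S ≡ ⊤
closed-lazy⇒≡⊤ p H {S} closed (t , burnt) =
  trans (sym (iterate-fixed (step p H) (⊆-antisym closed (⊆-step p H)) t)) burnt

module Comparison (H : Hypergraph) (m : ℕ) {p q : ℚ}
  (p-ignites-at-m : ∀ {e} → e ∈ₗ edges H → threshold p e ℤ.≤ + m)
  (q-needs-more-than-m : ∀ {e} → e ∈ₗ edges H → + m ℤ.< threshold q e) where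

  private
    N = n H
    E = edges H

  burns-under-p : ∀ {e G} → e ∈ₗ E → m ≤ ∣ e ∩ G ∣ → e ⊆ step p H G
  burns-under-p e∈E m≤ = spreadEdges⊆step p H ∘ spreadEdges⁺ p _ e∈E (ℤP.≤-trans (p-ignites-at-m e∈E) (+≤+ m≤))

  ignites-under-q⇒m< : ∀ {e F} → e ∈ₗ E → Ignites q F e → m < ∣ e ∩ F ∣
  ignites-under-q⇒m< e∈E ign = ℤP.drop‿+<+ (ℤP.<-≤-trans (q-needs-more-than-m e∈E) ign)

  spread-dominated : ∀ {F G} → (∀ {e} → e ∈ₗ E → ∣ e ∩ F ∣ ≤ suc ∣ e ∩ G ∣) →
                     spreadEdges q E F ⊆ step p H G
  spread-dominated {F} slack x∈ = case ∈spreadEdges⁻ q F E x∈ of λ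
    (e , e∈E , ign , x∈e) → burns-under-p e∈E (≤-pred (≤-trans (ignites-under-q⇒m< e∈E ign) (slack e∈E))) x∈e

  step-dominated : ∀ {F G} → F ⊆ G → step q H F ⊆ step p H G
  step-dominated F⊆G =
    ∪-⊆ (⊆-step p H ∘ F⊆G) (spread-dominated λ {e} _ → m≤n⇒m≤1+n (p⊆q⇒∣p∣≤∣q∣ (∩-monoʳ e F⊆G)))

  iterate-dominated : ∀ t {X Y} → X ⊆ Y → iterate (step q H) t X ⊆ iterate (step p H) t Y
  iterate-dominated zero    X⊆Y = X⊆Y
  iterate-dominated (suc t) X⊆Y = step-dominated (iterate-dominated t X⊆Y)

  lazy-dominated : ∀ {X Y} → X ⊆ step p H Y → IsLazyBurningSet q H X → IsLazyBurningSet p H Y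
  lazy-dominated {X} {Y} X⊆ (t , burnt) = suc t , ⊤⊆⇒≡⊤ λ {x} _ →
    subst (x ∈_) (sym (iterate-suc (step p H) Y t)) (iterate-dominated t X⊆ (subst (x ∈_) (sym burnt) ∈⊤))

  edge-above-m : ∀ {e₀ S} → e₀ ∈ₗ E → m < ∣ e₀ ∣ → IsLazyBurningSet q H S → ∃ λ e → e ∈ₗ E × m < ∣ e ∩ S ∣
  edge-above-m {e₀} {S} e₀∈E m<∣e₀∣ lazy with any? (λ e → m <? ∣ e ∩ S ∣) E
  ... | yes found = find found
  ... | no none   = contradiction (lose e₀∈E m<∣e₀∩S∣) none
    where
    closed : step q H S ⊆ S
    closed = ∪-⊆ (λ x∈S → x∈S) λ x∈spread → case ∈spreadEdges⁻ q S E x∈spread of λ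
      (e , e∈E , ign , _) → contradiction (lose e∈E (ignites-under-q⇒m< e∈E ign)) none
    m<∣e₀∩S∣ : m < ∣ e₀ ∩ S ∣
    m<∣e₀∩S∣ = subst (λ X → m < ∣ e₀ ∩ X ∣) (sym (closed-lazy⇒≡⊤ q H closed lazy))
                 (subst (m <_) (cong ∣_∣ (sym (∩-identityʳ e₀))) m<∣e₀∣)

  lazy-without-a-vertex : ∀ {e S} → e ∈ₗ E → m < ∣ e ∩ S ∣ → IsLazyBurningSet q H S →
                          ∃ λ S' → IsLazyBurningSet p H S' × ∣ S' ∣ < ∣ S ∣
  lazy-without-a-vertex {e} {S} e∈E m<∣e∩S∣ lazy with 0<∣p∣⇒nonempty (≤-<-trans z≤n m<∣e∩S∣)
  ... | v , v∈e∩S = S - v , lazy-dominated S⊆ lazy , x∈p⇒∣p-x∣<∣p∣ v∈S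
    where
    v∈S = proj₂ (x∈p∩q⁻ e S v∈e∩S)
    e⊆ : e ⊆ step p H (S - v)
    e⊆ = burns-under-p e∈E (≤-pred (≤-trans m<∣e∩S∣ (∣e∩p∣≤1+∣e∩q∣ e (p⊆p-x∪⁅x⁆ S v))))
    S⊆ : S ⊆ step p H (S - v)
    S⊆ = ⊆-trans (p⊆p-x∪⁅x⁆ S v) (∪⁅x⁆⊆ (⊆-step p H) (e⊆ (proj₁ (x∈p∩q⁻ e S v∈e∩S))))

  lazy-burning-number-< : ∀ {e₀ b₁ b₂} → e₀ ∈ₗ E → m < ∣ e₀ ∣ →
                          IsLazyBurningNumber p H b₁ → IsLazyBurningNumber q H b₂ → b₁ < b₂
  lazy-burning-number-< e₀∈E m<∣e₀∣ (_ , minimal) ((S , lazy , refl) , _) with edge-above-m e₀∈E m<∣e₀∣ lazy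
  ... | e , e∈E , m<∣e∩S∣ with lazy-without-a-vertex e∈E m<∣e∩S∣ lazy
  ...   | S' , lazy' , ∣S'∣<∣S∣ = ≤-<-trans (minimal S' lazy') ∣S'∣<∣S∣

  dominated-burns : ∀ {F G} us → burnsFrom q H F us → F ⊆ G → BurnsWithin p H G (length us)
  dominated-burns []       F≡⊤            F⊆G = [] , ⊤⊆⇒≡⊤ (λ x∈⊤ → F⊆G (subst (_ ∈_) (sym F≡⊤) x∈⊤)) , z≤n
  dominated-burns (u ∷ us) (_ , burns) F⊆G =
    burns-matching p H (step-dominated F⊆G) (dominated-burns us burns)

  spreading-edge∋source : ∀ {F e u x} → step q H F ⊆ F → e ∈ₗ E → Ignites q (step q H F ∪ ⁅ u ⁆) e →
                          x ∈ e → x ∉ step q H F ∪ ⁅ u ⁆ → u ∈ e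
  spreading-edge∋source {F} {e} {u} closed e∈E ign x∈e x∉F₁ = decidable-stable (u ∈? e) λ u∉e →
    x∉F₁ (x∈p∪q⁺ (inj₁ (⊆-step q H (closed (spreadEdges⊆step q H
      (spreadEdges⁺ q F e∈E (ignites-mono q {e = e} (p⊆q⇒∣p∣≤∣q∣ (e∩F₁⊆e∩F u∉e)) ign) x∈e))))))
    where
    e∩F₁⊆e∩F : u ∉ e → e ∩ (step q H F ∪ ⁅ u ⁆) ⊆ e ∩ F
    e∩F₁⊆e∩F u∉e y∈ = let y∈e , y∈F₁ = x∈p∩q⁻ e _ y∈ in
      x∈p∩q⁺ (y∈e , Sum.[ closed , (λ y∈⁅u⁆ → contradiction (subst (_∈ e) (x∈⁅y⁆⇒x≡y u y∈⁅u⁆) y∈e) u∉e) ]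
                          (x∈p∪q⁻ (step q H F) ⁅ u ⁆ y∈F₁))

  -- The edge that spreads first under q contains the newest source u and already holds m vertices
  -- of G: under p it burns from G, u included, one round earlier.
  first-spread-dominated : ∀ {F G u x} → step q H F ⊆ F → F ⊆ G →
                           x ∈ step q H (step q H F ∪ ⁅ u ⁆) → x ∉ step q H F ∪ ⁅ u ⁆ →
                           step q H (step q H F ∪ ⁅ u ⁆) ⊆ step p H G
  first-spread-dominated {F} {G} {u} closed F⊆G x∈ x∉F₁ =
    case ∈spreadEdges⁻ q _ E (∈step∧∉⇒∈spreadEdges q H x∈ x∉F₁) of λ (e , e∈E , ign , x∈e) →
      ∪-⊆ (∪⁅x⁆⊆ (⊆-step p H ∘ F⊆G ∘ closed)
                 (spread-dominated slack (spreadEdges⁺ q _ e∈E ign (spreading-edge∋source closed e∈E ign x∈e x∉F₁))))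
          (spread-dominated slack)
    where
    slack : ∀ {e} → e ∈ₗ E → ∣ e ∩ (step q H F ∪ ⁅ u ⁆) ∣ ≤ suc ∣ e ∩ G ∣
    slack {e} _ = ∣e∩p∣≤1+∣e∩q∣ e (∪-monoˡ (F⊆G ∘ closed))

  ahead-burns : ∀ {F G x} us → burnsFrom q H F us → x ∉ F → step q H F ⊆ step p H G →
                BurnsWithin p H G (length us)
  ahead-burns []       F≡⊤          x∉F _     = contradiction (subst (_ ∈_) (sym F≡⊤) ∈⊤) x∉F
  ahead-burns (u ∷ us) (_ , burns) _   ahead = burns-matching p H ahead (dominated-burns us burns)

  -- As long as the q-fire has not spread, F is exactly the set of sources played so far.
  saves-round-or-all-sources : ∀ {F G u} us → burnsFrom q H F (u ∷ us) → step q H F ⊆ F → F ⊆ G →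
                               BurnsWithin p H G (length us) ⊎ N ≤ ∣ F ∣ + suc (length us)
  saves-round-or-all-sources {F} {G} {u} us (_ , burns) closed F⊆G with u ∈? G
  ... | yes u∈G = inj₁ (dominated-burns us burns (∪⁅x⁆⊆ (F⊆G ∘ closed) u∈G))
  ... | no u∉G  = Sum.[ quiet us burns , (λ (_ , x∈ , x∉F₁) → inj₁ (ahead-burns us burns x∉F₁
                                              (first-spread-dominated closed F⊆G x∈ x∉F₁))) ]
                      (⊆-or-outside (step q H F₁) F₁)
    where
    F₁ = step q H F ∪ ⁅ u ⁆
    ∣F₁∣≤1+∣F∣ : ∣ F₁ ∣ ≤ suc ∣ F ∣
    ∣F₁∣≤1+∣F∣ = ∣step∪⁅w⁆∣≤1+∣G∣ q H closed
    quiet : ∀ us → burnsFrom q H F₁ us → step q H F₁ ⊆ F₁ →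
            BurnsWithin p H G (length us) ⊎ N ≤ ∣ F ∣ + suc (length us)
    quiet []       F₁≡⊤        _       = inj₂ (subst (N ≤_) (+-comm 1 ∣ F ∣) (≤-trans (≡⊤⇒n≤∣p∣ F₁≡⊤) ∣F₁∣≤1+∣F∣))
    quiet (_ ∷ us) burns closed₁ =
      Sum.map (burns-after p H u∉G)
              (λ N≤ → ≤-trans N≤ (≤-trans (+-monoˡ-≤ (suc (length us)) ∣F₁∣≤1+∣F∣)
                                           (≤-reflexive (sym (+-suc ∣ F ∣ (suc (length us)))))))
              (saves-round-or-all-sources us burns closed₁ (∪-monoˡ (step-dominated F⊆G)))

  singleton-closed : 1 ≤ m → ∀ u → step q H ⁅ u ⁆ ⊆ ⁅ u ⁆
  singleton-closed 1≤m u = ∪-⊆ (λ x∈ → x∈) λ x∈spread → case ∈spreadEdges⁻ q ⁅ u ⁆ E x∈spread of λ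
    (e , e∈E , ign , _) → contradiction (≤-trans (∣p∩q∣≤∣q∣ e ⁅ u ⁆) (≤-trans (≤-reflexive (∣⁅x⁆∣≡1 u)) 1≤m))
                                        (<⇒≱ (ignites-under-q⇒m< e∈E ign))

  shorter-or-all-sources : 1 ≤ m → ∀ s → IsBurningSequence q H s →
    (Σ (List (Fin N)) λ s' → IsBurningSequence p H s' × length s' < length s) ⊎ N ≤ length s
  shorter-or-all-sources _ []           ⊥≡⊤   = inj₂ (subst (N ≤_) (∣⊥∣≡0 N) (≡⊤⇒n≤∣p∣ ⊥≡⊤))
  shorter-or-all-sources _ (u ∷ [])     ⁅u⁆≡⊤ = inj₂ (subst (N ≤_) (∣⁅x⁆∣≡1 u) (≡⊤⇒n≤∣p∣ ⁅u⁆≡⊤))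
  shorter-or-all-sources 1≤m (u ∷ _ ∷ us) burns =
    Sum.map (λ (vs , burns' , len≤) → u ∷ vs , burns' , s≤s (s≤s len≤))
            (subst (λ k → N ≤ k + suc (length us)) (∣⁅x⁆∣≡1 u))
            (saves-round-or-all-sources us burns (singleton-closed 1≤m u) (λ x∈ → x∈))

  module _ {e y} (e∈E : e ∈ₗ E) (m<∣e∣ : m < ∣ e ∣) (y∉e : y ∉ e) where

    private
      ∈e⇒≢y : ∀ {x} → x ∈ e → x ≢ y
      ∈e⇒≢y x∈e refl = y∉e x∈e

    -- Burn the vertices of e one at a time, keeping y unburned, until some vertex catches fire unchosen.
    burns-filling : ∀ t {G x} → x ∈ e → x ∉ G → y ∉ G → N ≤ t + suc ∣ G ∣ → BurnsWithin p H G t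
    burns-filling zero    x∈e x∉G y∉G N≤ = contradiction N≤ (<⇒≱ (two-outside x∉G y∉G (∈e⇒≢y x∈e)))
    burns-filling (suc t) {G} {x} x∈e x∉G y∉G N≤ with ⊆-or-outside (step p H G) G
    ... | inj₂ (z , z∈ , z∉G) = burns-gaining p H (suc t) z∈ z∉G x∉G y∉G (∈e⇒≢y x∈e) N≤
    ... | inj₁ closed =
      let x' , x'∈e , x'∉G' = ⊈⇒outside e⊈G' in
      burns-after p H x∉G (burns-filling t x'∈e x'∉G' y∉G' (m≤1+n+o∧o<p⇒m≤n+p N≤ (s≤s (∣G∣<∣step∪⁅w⁆∣ p H x∉G))))
      where
      G' = step p H G ∪ ⁅ x ⁆
      ∣e∩G∣<m : ∣ e ∩ G ∣ < m
      ∣e∩G∣<m = ≰⇒> λ m≤ → x∉G (closed (burns-under-p e∈E m≤ x∈e))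
      e⊈G' : ¬ e ⊆ G'
      e⊈G' e⊆G' = <⇒≱ m<∣e∣ (begin
        ∣ e ∣          ≤⟨ p⊆q⇒∣p∣≤∣q∣ (λ x∈ → x∈p∩q⁺ (x∈ , e⊆G' x∈)) ⟩
        ∣ e ∩ G' ∣     ≤⟨ ∣e∩p∣≤1+∣e∩q∣ e (∪-monoˡ closed) ⟩
        suc ∣ e ∩ G ∣  ≤⟨ ∣e∩G∣<m ⟩
        m              ∎)
        where open ≤-Reasoning
      y∉G' : y ∉ G'
      y∉G' = Sum.[ y∉G ∘ closed , (λ y∈⁅x⁆ → ∈e⇒≢y x∈e (sym (x∈⁅y⁆⇒x≡y x y∈⁅x⁆))) ] ∘ x∈p∪q⁻ (step p H G) ⁅ x ⁆

    burning-sequence-<n : 1 ≤ m → Σ (List (Fin N)) λ s → IsBurningSequence p H s × length s < N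
    burning-sequence-<n 1≤m =
      let x₀ , x₀∈e = 0<∣p∣⇒nonempty (≤-<-trans z≤n m<∣e∣)
          x , x∈e , x∉⁅x₀⁆ = ⊈⇒outside (e⊈⁅x⁆ x₀)
          y∉⁅x₀⁆ = λ y∈⁅x₀⁆ → ∈e⇒≢y x₀∈e (sym (x∈⁅y⁆⇒x≡y x₀ y∈⁅x₀⁆))
          2≤N = <⇒≤ (subst (λ k → suc k < N) (∣⁅x⁆∣≡1 x₀) (two-outside x∉⁅x₀⁆ y∉⁅x₀⁆ (∈e⇒≢y x∈e)))
          N≤ = subst (λ k → N ≤ (N ∸ 2) + suc k) (sym (∣⁅x⁆∣≡1 x₀)) (≤-reflexive (sym (m∸n+n≡m 2≤N)))
          us , burns , len≤ = burns-filling (N ∸ 2) x∈e x∉⁅x₀⁆ y∉⁅x₀⁆ N≤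
      in x₀ ∷ us , burns , ≤-trans (s≤s (s≤s len≤)) (≤-reflexive (m+[n∸m]≡n 2≤N))
      where
      e⊈⁅x⁆ : ∀ x → ¬ e ⊆ ⁅ x ⁆
      e⊈⁅x⁆ x e⊆⁅x⁆ = <⇒≱ m<∣e∣ (≤-trans (p⊆q⇒∣p∣≤∣q∣ e⊆⁅x⁆) (≤-trans (≤-reflexive (∣⁅x⁆∣≡1 x)) 1≤m))

    burning-number-< : ∀ {b₁ b₂} → 1 ≤ m → IsBurningNumber p H b₁ → IsBurningNumber q H b₂ → b₁ < b₂
    burning-number-< 1≤m (_ , minimal) ((s , burns , refl) , _) with shorter-or-all-sources 1≤m s burns
    ... | inj₁ (s' , burns' , shorter) = ≤-<-trans (minimal s' burns') shorter
    ... | inj₂ N≤ = let s' , burns' , shorter = burning-sequence-<n 1≤m in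
                    ≤-<-trans (minimal s' burns') (<-≤-trans shorter N≤)

distinct-edges⇒edge-missing-vertex : ∀ H → MultipleDistinctEdges H → ∃ λ e → e ∈ₗ edges H × ∃ λ y → y ∉ e
distinct-edges⇒edge-missing-vertex H (e , f , e∈E , f∈E , e≢f) with ≡⊤-or-outside e | ≡⊤-or-outside f
... | inj₂ (y , y∉e) | _              = e , e∈E , y , y∉e
... | inj₁ _         | inj₂ (y , y∉f) = f , f∈E , y , y∉f
... | inj₁ e≡⊤       | inj₁ f≡⊤       = contradiction (trans e≡⊤ (sym f≡⊤)) e≢f

theorem3p7 : (H : Hypergraph) (k m : ℕ) .{{_ : NonZero k}} (p₂ : ℚ)
    → NonemptyVertices H → Uniform k H → MultipleDistinctEdges H
    → 1 ≤ m → m < k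
    → (+ m / k) <ℚ p₂ → p₂ <ℚ (+ (suc m) / k)
    → (∀ b₁ b₂ → IsLazyBurningNumber (+ m / k) H b₁ → IsLazyBurningNumber p₂ H b₂ → b₁ < b₂)
      × (∀ b₁ b₂ → IsBurningNumber (+ m / k) H b₁ → IsBurningNumber p₂ H b₂ → b₁ < b₂)
theorem3p7 H k m p₂ _ uniform distinct 1≤m m<k m/k<p₂ _
  with distinct-edges⇒edge-missing-vertex H distinct
... | e , e∈E , y , y∉e =
  (λ _ _ → C.lazy-burning-number-< e∈E m<∣e∣) , (λ _ _ → C.burning-number-< e∈E m<∣e∣ y∉e 1≤m)
  where
  ∣e∣≡k : ∀ {e} → e ∈ₗ edges H → ∣ e ∣ ≡ k
  ∣e∣≡k = All.lookup uniform
  m<∣e∣ : m < ∣ e ∣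
  m<∣e∣ = subst (m <_) (sym (∣e∣≡k e∈E)) m<k
  module C = Comparison H m {+ m / k} {p₂}
    (λ {e} e∈E → threshold[m/k]≤m k m e (∣e∣≡k e∈E))
    (λ {e} e∈E → m/k<p⇒m<threshold k m p₂ e (∣e∣≡k e∈E) m/k<p₂)
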